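{- Let $f(x)=a_nx^n+\dots+a_0$ be a polynomial of degree $n$ with integer coefficients and let $q$ be an odd prime. Suppose $a_0\not\equiv 0 \pmod q$ and that the congruence $f(x)\equiv 0\pmod q$ has $\ell$ solutions in $\mathbb{Z}_q$. Then $$R(f(x),x^{q-1}-1)= a_n^{q-1}\prod_{i=1}^n(\alpha_i^{q-1}-1)\equiv 0 \pmod{q^\ell},$$ where $\alpha_1,\dots,\alpha_n$ are the complex roots of $f(x)$, each repeated according to its multiplicity.
   Context: For $f(x)=\sum_{i=0}^n a_i x^i$ and $g(x)=\sum_{j=0}^m b_j x^j$ of degrees $n$ and $m$, the resultant $R(f,g)$ is the determinant of the Sylvester matrix; equivalently $R(f,g)=a_n^m\prod_{i=1}^n g(\alpha_i)$, where $\alpha_i$ are the roots of $f$ with multiplicity. -}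

module Defs where

open import Data.Nat as ℕ using (ℕ; zero; suc)
open import Data.Nat.Divisibility as ℕD using (_∣?_)
open import Data.Integer as ℤ using (ℤ; +_; -_; _+_; _*_; _^_; ∣_∣)
open import Data.Fin as Fin using (Fin; toℕ; fromℕ; punchIn)
open import Data.List using (List; length; filter; upTo)
open import Data.Bool using (if_then_else_)
open import Relation.Nullary using (yes; no)

sumℤ : ∀ {k} → (Fin k → ℤ) → ℤ
sumℤ {zero}  f = + 0
sumℤ {suc k} f = f Fin.zero + sumℤ (λ i → f (Fin.suc i))

sgn : ℕ → ℤ
sgn j = (- (+ 1)) ^ j

det : ∀ {k} → (Fin k → Fin k → ℤ) → ℤ
det {zero}  M = + 1
det {suc k} M =
  sumℤ (λ j → sgn (toℕ j) * (M Fin.zero j * det (λ r c → M (Fin.suc r) (punchIn j c))))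

-- A polynomial of (formal) degree n is given by its coefficient function
-- a : Fin (suc n) → ℤ, where a i is the coefficient of x^i.
eval : ∀ {n} → (Fin (suc n) → ℤ) → ℤ → ℤ
eval a x = sumℤ (λ i → a i * (x ^ toℕ i))

coeff : ∀ {n} → (Fin (suc n) → ℤ) → ℕ → ℤ
coeff {n} a i with i ℕ.<? suc n
... | yes p = a (Fin.fromℕ< p)
... | no _  = + 0

-- entry in column j of the Sylvester row that carries the coefficients
-- a_n, a_{n-1}, ..., a_0 starting at column s
shifted : ∀ {n} → (Fin (suc n) → ℤ) → ℕ → ℕ → ℤ
shifted {n} a s j with s ℕ.≤? j | j ℕ.≤? n ℕ.+ s
... | yes _ | yes _ = coeff a (n ℕ.+ s ℕ.∸ j)
... | _     | _     = + 0

-- Sylvester matrix of f (degree n, coefficients a) and g (degree m, coefficients b):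
-- an (m+n)×(m+n) matrix; rows 0..m-1 are shifts of (a_n,...,a_0),
-- rows m..m+n-1 are shifts of (b_m,...,b_0).
sylvester : ∀ {n m} → (Fin (suc n) → ℤ) → (Fin (suc m) → ℤ) → Fin (m ℕ.+ n) → Fin (m ℕ.+ n) → ℤ
sylvester {n} {m} a b r c with toℕ r ℕ.<? m
... | yes _ = shifted a (toℕ r) (toℕ c)
... | no _  = shifted b (toℕ r ℕ.∸ m) (toℕ c)

resultant : ∀ {n m} → (Fin (suc n) → ℤ) → (Fin (suc m) → ℤ) → ℤ
resultant a b = det (sylvester a b)

xPowMinusOne : (m : ℕ) → Fin (suc m) → ℤ
xPowMinusOne m i with toℕ i ℕ.≟ 0 | toℕ i ℕ.≟ m
... | yes _ | _     = - (+ 1)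
... | no _  | yes _ = + 1
... | no _  | no _  = + 0

numRootsMod : ∀ {n} → (Fin (suc n) → ℤ) → ℕ → ℕ
numRootsMod a q = length (filter (λ x → q ∣? ∣ eval a (+ x) ∣) (upTo q))

-- Write R(f, x^(q-1) - 1) as the determinant of the Sylvester matrix S and read row i of S as the
-- coefficient list of a polynomial P_i in the column variable: the P_i are x^j f(x) and x^j (x^(q-1) - 1).
-- Since q ∤ a₀, each root r of f mod q is nonzero, so by Fermat it is a common root of all P_i mod q.
-- The column operations col (c+1) += r · col c keep det S and turn the columns into partial Horner
-- values at r: the last one becomes P_i(r) ≡ 0, and the others are the coefficients of P_i(x)/(x - r),
-- which still vanish at the remaining roots because the roots are pairwise incongruent mod q.
-- Repeating this for each of the ℓ roots yields ℓ columns divisible by q.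

module Submission where

-- A separate module because its signed _∣_ would clash with the unsigned _∣_ of the statement.
module Lemmas where

  open import Data.Nat as ℕ using (ℕ; zero; suc; _≤_; _<_; z≤n; s≤s; _∸_)
  import Data.Nat.Properties as ℕ
  import Data.Nat.Divisibility as ℕ
  import Data.Nat.Tactic.RingSolver as NS
  open import Data.Nat.Combinatorics using (_C_; nCn≡1; nC1≡n; nCk+nC[k+1]≡[n+1]C[k+1])
  open import Data.Nat.Primality using (Prime; euclidsLemma)
  open import Data.Integer as ℤ using (ℤ; +_; -_; _+_; _*_; _-_; _^_)
  import Data.Integer.Properties as ℤ
  open import Data.Integer.Tactic.RingSolver using (solve-∀)
  import Data.Integer.Divisibility as Unsigned
  open import Data.Integer.Divisibility.Signed
    using (_∣_; divides; ∣ᵤ⇒∣; ∣⇒∣ᵤ; ∣m∣n⇒∣m+n; ∣m∣n⇒∣m-n; ∣m⇒∣-m; ∣m⇒∣m*n; ∣n⇒∣m*n)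
  open import Data.Fin as Fin using (Fin; toℕ; fromℕ; inject₁; punchIn)
  import Data.Fin.Properties as Fin
  open import Data.Vec.Functional using (Vector; tail; init)
  open import Data.Sum using (_⊎_; inj₁; inj₂)
  open import Data.Product using (Σ-syntax; _,_; _×_)
  open import Data.List as List using (List; []; _∷_; length; filter; applyUpTo)
  import Data.List.Properties as List
  open import Data.List.Relation.Unary.All as All using (All; []; _∷_)
  import Data.List.Relation.Unary.All.Properties as AllP
  open import Data.List.Relation.Unary.AllPairs using (AllPairs; []; _∷_)
  import Data.List.Relation.Unary.AllPairs.Properties as AllPairsP
  open import Data.Empty using (⊥-elim)
  open import Function using (_∘_)
  open import Relation.Nullary using (¬_; Dec; yes; no)
  open import Relation.Binary.PropositionalEquality
  open ≡-Reasoning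
  import Algebra.Definitions.RawSemiring ℤ.+-*-rawSemiring as Raw
  open import Algebra.Properties.CommutativeSemiring.Binomial ℤ.+-*-commutativeSemiring
    using (binomialTerm) renaming (theorem to binomial-theorem)
  open import Algebra.Properties.Monoid.Sum ℤ.+-0-monoid using (sum; sum-init-last)
  open import Defs using (sumℤ; sgn; det; eval; coeff; shifted; sylvester; resultant; xPowMinusOne; numRootsMod)

  ∑ : ℕ → (ℕ → ℤ) → ℤ
  ∑ zero    f = + 0
  ∑ (suc k) f = f 0 + ∑ k (f ∘ suc)

  ∑-cong : ∀ k {f g} → (∀ i → i < k → f i ≡ g i) → ∑ k f ≡ ∑ k g
  ∑-cong zero    f≡g = refl
  ∑-cong (suc k) f≡g = cong₂ _+_ (f≡g 0 (s≤s z≤n)) (∑-cong k (λ i i<k → f≡g (suc i) (s≤s i<k)))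

  ∑-zero : ∀ k {f} → (∀ i → i < k → f i ≡ + 0) → ∑ k f ≡ + 0
  ∑-zero zero    f≡0 = refl
  ∑-zero (suc k) f≡0 = cong₂ _+_ (f≡0 0 (s≤s z≤n)) (∑-zero k (λ i i<k → f≡0 (suc i) (s≤s i<k)))

  ∑-linear : ∀ k f g μ ν → ∑ k (λ i → μ * f i + ν * g i) ≡ μ * ∑ k f + ν * ∑ k g
  ∑-linear zero    f g μ ν = sym (cong₂ _+_ (ℤ.*-zeroʳ μ) (ℤ.*-zeroʳ ν))
  ∑-linear (suc k) f g μ ν = begin
    (μ * f 0 + ν * g 0) + ∑ k (λ i → μ * f (suc i) + ν * g (suc i))
      ≡⟨ cong (λ s → (μ * f 0 + ν * g 0) + s) (∑-linear k (f ∘ suc) (g ∘ suc) μ ν) ⟩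
    (μ * f 0 + ν * g 0) + (μ * ∑ k (f ∘ suc) + ν * ∑ k (g ∘ suc))
      ≡⟨ regroup μ ν (f 0) (g 0) (∑ k (f ∘ suc)) (∑ k (g ∘ suc)) ⟩
    μ * (f 0 + ∑ k (f ∘ suc)) + ν * (g 0 + ∑ k (g ∘ suc)) ∎
    where
    regroup : ∀ μ ν a b c d → (μ * a + ν * b) + (μ * c + ν * d) ≡ μ * (a + c) + ν * (b + d)
    regroup = solve-∀

  ∑-cancel-adjacent : ∀ k d f → suc d < k →
    (∀ i → i < k → i ≢ d → i ≢ suc d → f i ≡ + 0) → f d + f (suc d) ≡ + 0 → ∑ k f ≡ + 0
  ∑-cancel-adjacent (suc (suc k)) zero f _ f≡0 pair≡0 = begin
    f 0 + (f 1 + ∑ k (f ∘ suc ∘ suc))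
      ≡⟨ cong (λ s → f 0 + (f 1 + s)) (∑-zero k (λ i i<k → f≡0 (2 ℕ.+ i) (s≤s (s≤s i<k)) (λ ()) (λ ()))) ⟩
    f 0 + (f 1 + + 0)
      ≡⟨ cong (λ s → f 0 + s) (ℤ.+-identityʳ (f 1)) ⟩
    f 0 + f 1
      ≡⟨ pair≡0 ⟩
    + 0 ∎
  ∑-cancel-adjacent (suc k) (suc d) f (s≤s d<k) f≡0 pair≡0 =
    cong₂ _+_ (f≡0 0 (s≤s z≤n) (λ ()) (λ ()))
              (∑-cancel-adjacent k d (f ∘ suc) d<k
                 (λ i i<k i≢d i≢1+d → f≡0 (suc i) (s≤s i<k) (i≢d ∘ ℕ.suc-injective) (i≢1+d ∘ ℕ.suc-injective))
                 pair≡0)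

  ∣-∑ : ∀ k {d f} → (∀ i → i < k → d ∣ f i) → d ∣ ∑ k f
  ∣-∑ zero    d∣f = divides (+ 0) refl
  ∣-∑ (suc k) d∣f = ∣m∣n⇒∣m+n (d∣f 0 (s≤s z≤n)) (∣-∑ k (λ i i<k → d∣f (suc i) (s≤s i<k)))

  punch : ℕ → ℕ → ℕ
  punch zero    c       = suc c
  punch (suc j) zero    = zero
  punch (suc j) (suc c) = suc (punch j c)

  toℕ-punchIn : ∀ {k} (j : Fin (suc k)) (c : Fin k) → toℕ (punchIn j c) ≡ punch (toℕ j) (toℕ c)
  toℕ-punchIn Fin.zero    c          = refl
  toℕ-punchIn (Fin.suc j) Fin.zero    = refl
  toℕ-punchIn (Fin.suc j) (Fin.suc c) = cong suc (toℕ-punchIn j c)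

  punch-≢ : ∀ j c → punch j c ≢ j
  punch-≢ (suc j) (suc c) eq = punch-≢ j c (ℕ.suc-injective eq)

  punch-injective : ∀ j {c c′} → punch j c ≡ punch j c′ → c ≡ c′
  punch-injective zero                    eq = ℕ.suc-injective eq
  punch-injective (suc j) {zero}  {zero}  eq = refl
  punch-injective (suc j) {suc c} {suc c′} eq = cong suc (punch-injective j (ℕ.suc-injective eq))

  punch-< : ∀ {k} j {c} → c < k → punch j c < suc k
  punch-< zero            c<k       = s≤s c<k
  punch-< (suc j) {zero}  c<k       = s≤s z≤n
  punch-< (suc j) {suc c} (s≤s c<k) = s≤s (punch-< j c<k)

  c≤punch : ∀ j c → c ≤ punch j c
  c≤punch zero    c       = ℕ.n≤1+n c
  c≤punch (suc j) zero    = z≤n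
  c≤punch (suc j) (suc c) = s≤s (c≤punch j c)

  punch-≥ : ∀ {j c} → j ≤ c → punch j c ≡ suc c
  punch-≥ {zero}          z≤n       = refl
  punch-≥ {suc j} {suc c} (s≤s j≤c) = cong suc (punch-≥ j≤c)

  punch-surjective : ∀ {k} j c → j < suc k → c < suc k → j ≢ c → Σ[ c′ ∈ ℕ ] punch j c′ ≡ c × c′ < k
  punch-surjective zero zero _ _ j≢c = ⊥-elim (j≢c refl)
  punch-surjective zero (suc c) _ (s≤s c<k) _ = c , refl , c<k
  punch-surjective {zero}  (suc j) zero (s≤s ()) _ _
  punch-surjective {suc k} (suc j) zero _ _ _ = zero , refl , s≤s z≤n
  punch-surjective {suc k} (suc j) (suc c) (s≤s j<k) (s≤s c<k) j≢c
    with punch-surjective j c j<k c<k (j≢c ∘ cong suc)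
  ... | c′ , eq , c′<k = suc c′ , cong suc eq , s≤s c′<k

  punch-surjective-adjacent : ∀ {k} j d → j < suc k → suc d < suc k → j ≢ d → j ≢ suc d →
    Σ[ d′ ∈ ℕ ] punch j d′ ≡ d × punch j (suc d′) ≡ suc d × suc d′ < k
  punch-surjective-adjacent zero zero _ _ j≢d _ = ⊥-elim (j≢d refl)
  punch-surjective-adjacent zero (suc d) _ (s≤s d<k) _ _ = d , refl , refl , d<k
  punch-surjective-adjacent (suc zero) zero _ _ _ j≢1+d = ⊥-elim (j≢1+d refl)
  punch-surjective-adjacent {suc (suc k)} (suc (suc j)) zero _ _ _ _ = 0 , refl , refl , s≤s (s≤s z≤n)
  punch-surjective-adjacent {zero}     (suc (suc j)) zero (s≤s ()) _ _ _
  punch-surjective-adjacent {suc zero} (suc (suc j)) zero (s≤s (s≤s ())) _ _ _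
  punch-surjective-adjacent {suc k} (suc j) (suc d) (s≤s j<k) (s≤s d<k) j≢d j≢1+d
    with punch-surjective-adjacent j d j<k d<k (j≢d ∘ cong suc) (j≢1+d ∘ cong suc)
  ... | d′ , eq , eq′ , d′<k = suc d′ , cong suc eq , cong suc eq′ , s≤s d′<k

  punch-adjacent : ∀ (g : ℕ → ℤ) d → g d ≡ g (suc d) → ∀ c → g (punch d c) ≡ g (punch (suc d) c)
  punch-adjacent g zero    eq zero    = sym eq
  punch-adjacent g zero    eq (suc c) = refl
  punch-adjacent g (suc d) eq zero    = refl
  punch-adjacent g (suc d) eq (suc c) = punch-adjacent (g ∘ suc) d eq c

  Matrix : Set
  Matrix = ℕ → ℕ → ℤ

  minor : ℕ → Matrix → Matrix
  minor j N r c = N (suc r) (punch j c)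

  determinant : ℕ → Matrix → ℤ
  determinant zero    N = + 1
  determinant (suc k) N = ∑ (suc k) (λ j → sgn j * (N 0 j * determinant k (minor j N)))

  sumℤ-cong : ∀ {k} {f g : Fin k → ℤ} → (∀ i → f i ≡ g i) → sumℤ f ≡ sumℤ g
  sumℤ-cong {zero}  f≡g = refl
  sumℤ-cong {suc k} f≡g = cong₂ _+_ (f≡g Fin.zero) (sumℤ-cong (f≡g ∘ Fin.suc))

  sumℤ≡∑ : ∀ k (f : ℕ → ℤ) → sumℤ {k} (f ∘ toℕ) ≡ ∑ k f
  sumℤ≡∑ zero    f = refl
  sumℤ≡∑ (suc k) f = cong (λ s → f 0 + s) (sumℤ≡∑ k (f ∘ suc))

  det-cong : ∀ {k} {M M′ : Fin k → Fin k → ℤ} → (∀ r c → M r c ≡ M′ r c) → det M ≡ det M′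
  det-cong {zero}  M≡M′ = refl
  det-cong {suc k} M≡M′ = sumℤ-cong λ j →
    cong₂ (λ x D → sgn (toℕ j) * (x * D)) (M≡M′ Fin.zero j) (det-cong (λ r c → M≡M′ (Fin.suc r) (punchIn j c)))

  det≡determinant : ∀ k (N : Matrix) → det {k} (λ r c → N (toℕ r) (toℕ c)) ≡ determinant k N
  det≡determinant zero    N = refl
  det≡determinant (suc k) N = begin
    sumℤ (λ j → sgn (toℕ j) * (N 0 (toℕ j) * det {k} (λ r c → N (suc (toℕ r)) (toℕ (punchIn j c)))))
      ≡⟨ sumℤ-cong (λ j → cong (λ D → sgn (toℕ j) * (N 0 (toℕ j) * D)) (minor≡ j)) ⟩
    sumℤ {suc k} (λ j → sgn (toℕ j) * (N 0 (toℕ j) * determinant k (minor (toℕ j) N)))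
      ≡⟨ sumℤ≡∑ (suc k) (λ j → sgn j * (N 0 j * determinant k (minor j N))) ⟩
    determinant (suc k) N ∎
    where
    minor≡ : ∀ j → det {k} (λ r c → N (suc (toℕ r)) (toℕ (punchIn j c))) ≡ determinant k (minor (toℕ j) N)
    minor≡ j = trans (det-cong {k} (λ r c → cong (N (suc (toℕ r))) (toℕ-punchIn j c)))
                     (det≡determinant k (minor (toℕ j) N))

  determinant-cong : ∀ k {N N′} → (∀ r c → r < k → c < k → N r c ≡ N′ r c) →
    determinant k N ≡ determinant k N′
  determinant-cong zero    N≡N′ = refl
  determinant-cong (suc k) N≡N′ = ∑-cong (suc k) λ j j<k →
    cong₂ (λ x D → sgn j * (x * D)) (N≡N′ 0 j (s≤s z≤n) j<k)
      (determinant-cong k (λ r c r<k c<k → N≡N′ (suc r) (punch j c) (s≤s r<k) (punch-< j c<k)))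

  determinant-linear : ∀ k c {A B E : Matrix} μ ν → c < k →
    (∀ i x → x ≢ c → A i x ≡ B i x) → (∀ i x → x ≢ c → E i x ≡ B i x) →
    (∀ i → A i c ≡ μ * B i c + ν * E i c) →
    determinant k A ≡ μ * determinant k B + ν * determinant k E
  determinant-linear (suc k) c {A} {B} {E} μ ν c<k A≡B E≡B A≡μB+νE =
    trans (∑-cong (suc k) term) (∑-linear (suc k) (expansion B) (expansion E) μ ν)
    where
    expansion : Matrix → ℕ → ℤ
    expansion N j = sgn j * (N 0 j * determinant k (minor j N))

    minor-agree : ∀ {N N′} j → (∀ i x → x ≢ j → N′ i x ≡ N i x) →
                  determinant k (minor j N′) ≡ determinant k (minor j N)
    minor-agree j N′≡N = determinant-cong k (λ r x _ _ → N′≡N (suc r) (punch j x) (punch-≢ j x))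

    term : ∀ j → j < suc k → expansion A j ≡ μ * expansion B j + ν * expansion E j
    term j j<k with j ℕ.≟ c
    ... | yes refl = begin
      sgn j * (A 0 j * determinant k (minor j A))
        ≡⟨ cong₂ (λ x D → sgn j * (x * D)) (A≡μB+νE 0) (minor-agree j A≡B) ⟩
      sgn j * ((μ * B 0 j + ν * E 0 j) * determinant k (minor j B))
        ≡⟨ distribute μ ν (sgn j) (B 0 j) (E 0 j) (determinant k (minor j B)) ⟩
      μ * expansion B j + ν * (sgn j * (E 0 j * determinant k (minor j B)))
        ≡⟨ cong (λ D → μ * expansion B j + ν * (sgn j * (E 0 j * D))) (sym (minor-agree j E≡B)) ⟩
      μ * expansion B j + ν * expansion E j ∎
      where
      distribute : ∀ μ ν s b c D → s * ((μ * b + ν * c) * D) ≡ μ * (s * (b * D)) + ν * (s * (c * D))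
      distribute = solve-∀
    ... | no j≢c with punch-surjective j c j<k c<k j≢c
    ... | c′ , punch-c′ , c′<k = begin
      sgn j * (A 0 j * determinant k (minor j A))
        ≡⟨ cong₂ (λ x D → sgn j * (x * D)) (A≡B 0 j j≢c) minor-linear ⟩
      sgn j * (B 0 j * (μ * determinant k (minor j B) + ν * determinant k (minor j E)))
        ≡⟨ distribute μ ν (sgn j) (B 0 j) (determinant k (minor j B)) (determinant k (minor j E)) ⟩
      μ * expansion B j + ν * (sgn j * (B 0 j * determinant k (minor j E)))
        ≡⟨ cong (λ x → μ * expansion B j + ν * (sgn j * (x * determinant k (minor j E)))) (sym (E≡B 0 j j≢c)) ⟩
      μ * expansion B j + ν * expansion E j ∎
      where
      distribute : ∀ μ ν s b DB DC → s * (b * (μ * DB + ν * DC)) ≡ μ * (s * (b * DB)) + ν * (s * (b * DC))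
      distribute = solve-∀
      avoids-c : ∀ x → x ≢ c′ → punch j x ≢ c
      avoids-c x x≢c′ eq = x≢c′ (punch-injective j (trans eq (sym punch-c′)))
      minor-linear : determinant k (minor j A) ≡ μ * determinant k (minor j B) + ν * determinant k (minor j E)
      minor-linear = determinant-linear k c′ μ ν c′<k
        (λ i x x≢c′ → A≡B (suc i) (punch j x) (avoids-c x x≢c′))
        (λ i x x≢c′ → E≡B (suc i) (punch j x) (avoids-c x x≢c′))
        (λ i → subst (λ y → A (suc i) y ≡ μ * B (suc i) y + ν * E (suc i) y) (sym punch-c′) (A≡μB+νE (suc i)))

  determinant-adjacent-equal : ∀ k {N} d → suc d < k → (∀ i → N i d ≡ N i (suc d)) → determinant k N ≡ + 0
  determinant-adjacent-equal (suc k) {N} d d<k N-d≡N-1+d =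
    ∑-cancel-adjacent (suc k) d expansion d<k term≡0 pair≡0
    where
    expansion : ℕ → ℤ
    expansion j = sgn j * (N 0 j * determinant k (minor j N))

    term≡0 : ∀ j → j < suc k → j ≢ d → j ≢ suc d → expansion j ≡ + 0
    term≡0 j j<k j≢d j≢1+d with punch-surjective-adjacent j d j<k d<k j≢d j≢1+d
    ... | d′ , punch-d′ , punch-1+d′ , d′<k = begin
      sgn j * (N 0 j * determinant k (minor j N))
        ≡⟨ cong (λ D → sgn j * (N 0 j * D)) minor≡0 ⟩
      sgn j * (N 0 j * + 0)
        ≡⟨ cong (sgn j *_) (ℤ.*-zeroʳ (N 0 j)) ⟩
      sgn j * + 0
        ≡⟨ ℤ.*-zeroʳ (sgn j) ⟩
      + 0 ∎
      where
      minor≡0 : determinant k (minor j N) ≡ + 0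
      minor≡0 = determinant-adjacent-equal k d′ d′<k λ i → begin
        N (suc i) (punch j d′)       ≡⟨ cong (N (suc i)) punch-d′ ⟩
        N (suc i) d                  ≡⟨ N-d≡N-1+d (suc i) ⟩
        N (suc i) (suc d)            ≡⟨ cong (N (suc i)) punch-1+d′ ⟨
        N (suc i) (punch j (suc d′)) ∎

    same-minor : determinant k (minor (suc d) N) ≡ determinant k (minor d N)
    same-minor = determinant-cong k (λ r c _ _ → sym (punch-adjacent (N (suc r)) d (N-d≡N-1+d (suc r)) c))

    pair≡0 : expansion d + expansion (suc d) ≡ + 0
    pair≡0 = trans (cong₂ (λ x D → expansion d + (- (+ 1) * sgn d) * (x * D)) (sym (N-d≡N-1+d 0)) same-minor)
                   (opposite-signs (sgn d) (N 0 d) (determinant k (minor d N)))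
      where
      opposite-signs : ∀ s x D → s * (x * D) + (- (+ 1) * s) * (x * D) ≡ + 0
      opposite-signs = solve-∀

  replaceColumn : ℕ → (ℕ → ℤ) → Matrix → Matrix
  replaceColumn c v N i x with x ℕ.≟ c
  ... | yes _ = v i
  ... | no _  = N i x

  replaceColumn-≡ : ∀ c v N i → replaceColumn c v N i c ≡ v i
  replaceColumn-≡ c v N i with c ℕ.≟ c
  ... | yes _  = refl
  ... | no c≢c = ⊥-elim (c≢c refl)

  replaceColumn-≢ : ∀ {c} v N i {x} → x ≢ c → replaceColumn c v N i x ≡ N i x
  replaceColumn-≢ {c} v N i {x} x≢c with x ℕ.≟ c
  ... | yes x≡c = ⊥-elim (x≢c x≡c)
  ... | no _    = refl

  determinant-add-column : ∀ k {N N′} d t → suc d < k →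
    (∀ i x → x ≢ suc d → N′ i x ≡ N i x) → (∀ i → N′ i (suc d) ≡ N i (suc d) + t * N i d) →
    determinant k N′ ≡ determinant k N
  determinant-add-column k {N} {N′} d t d<k N′≡N N′-1+d = begin
    determinant k N′                                 ≡⟨ determinant-linear k (suc d) (+ 1) t d<k N′≡N R≡N N′≡N+tR ⟩
    + 1 * determinant k N + t * determinant k R      ≡⟨ cong (λ D → + 1 * determinant k N + t * D) R≡0 ⟩
    + 1 * determinant k N + t * + 0                  ≡⟨ drop-zero t (determinant k N) ⟩
    determinant k N                                  ∎
    where
    R : Matrix
    R = replaceColumn (suc d) (λ i → N i d) N
    R≡N : ∀ i x → x ≢ suc d → R i x ≡ N i x
    R≡N i x = replaceColumn-≢ (λ i → N i d) N i
    N′≡N+tR : ∀ i → N′ i (suc d) ≡ + 1 * N i (suc d) + t * R i (suc d)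
    N′≡N+tR i = trans (N′-1+d i)
      (cong₂ (λ x y → x + t * y) (sym (ℤ.*-identityˡ (N i (suc d)))) (sym (replaceColumn-≡ (suc d) (λ i → N i d) N i)))
    R≡0 : determinant k R ≡ + 0
    R≡0 = determinant-adjacent-equal k d d<k λ i →
      trans (R≡N i d (λ ())) (sym (replaceColumn-≡ (suc d) (λ i → N i d) N i))
    drop-zero : ∀ t D → + 1 * D + t * + 0 ≡ D
    drop-zero = solve-∀

  *-pres-∣ : ∀ {a b x y} → a ∣ x → b ∣ y → a * b ∣ x * y
  *-pres-∣ {a} {b} (divides u refl) (divides v refl) = divides (u * v) (regroup u a v b)
    where
    regroup : ∀ u a v b → (u * a) * (v * b) ≡ (u * v) * (a * b)
    regroup = solve-∀

  pow∣determinant : ∀ k p {N} d → (∀ i c → i < k → p ≤ c → c < k → d ∣ N i c) → d ^ (k ∸ p) ∣ determinant k N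
  pow∣determinant zero    p d _ rewrite ℕ.0∸n≡0 p = divides (+ 1) refl
  pow∣determinant (suc k) p {N} d d∣N = ∣-∑ (suc k) λ j j<k → ∣n⇒∣m*n (sgn j) (term p d∣N j j<k)
    where
    term : ∀ p → (∀ i c → i < suc k → p ≤ c → c < suc k → d ∣ N i c) →
           ∀ j → j < suc k → d ^ (suc k ∸ p) ∣ N 0 j * determinant k (minor j N)
    term p d∣N j (s≤s j≤k) with p ℕ.≤? j
    ... | yes p≤j = subst (λ e → d ^ e ∣ N 0 j * determinant k (minor j N))
                          (sym (ℕ.+-∸-assoc 1 (ℕ.≤-trans p≤j j≤k)))
                          (*-pres-∣ (d∣N 0 j (s≤s z≤n) p≤j (s≤s j≤k))
                                 (pow∣determinant k p d λ i c i<k p≤c c<k →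
                                    d∣N (suc i) (punch j c) (s≤s i<k) (ℕ.≤-trans p≤c (c≤punch j c)) (punch-< j c<k)))
    term zero     d∣N j _ | no p≰j = ⊥-elim (p≰j z≤n)
    term (suc p′) d∣N j _ | no p≰j = ∣n⇒∣m*n (N 0 j) (pow∣determinant k p′ d λ i c i<k p′≤c c<k →
      d∣N (suc i) (punch j c) (s≤s i<k) (subst (suc p′ ≤_) (sym (punch-≥ (ℕ.≤-trans j≤p′ p′≤c))) (s≤s p′≤c))
          (punch-< j c<k))
      where
      j≤p′ : j ≤ p′
      j≤p′ = ℕ.≤-pred (ℕ.≰⇒> p≰j)

  horner : (ℕ → ℤ) → ℕ → ℤ → ℤ
  horner v zero    x = + 0
  horner v (suc p) x = horner v p x * x + v p

  horner-cong : ∀ p {v w} x → (∀ c → c < p → v c ≡ w c) → horner v p x ≡ horner w p x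
  horner-cong zero    x v≡w = refl
  horner-cong (suc p) x v≡w =
    cong₂ (λ h y → h * x + y) (horner-cong p x (λ c c<p → v≡w c (ℕ.m≤n⇒m≤1+n c<p))) (v≡w p ℕ.≤-refl)

  horner-factor : ∀ v p x r →
    horner v (suc p) x - horner v (suc p) r ≡ (x - r) * horner (λ c → horner v (suc c) r) p x
  horner-factor v zero x r = cancel x r (v 0)
    where
    cancel : ∀ x r a → (+ 0 * x + a) - (+ 0 * r + a) ≡ (x - r) * + 0
    cancel = solve-∀
  horner-factor v (suc p) x r = begin
    (P * x + w) - (A * r + w)      ≡⟨ split P A x r w ⟩
    (P - A) * x + (x - r) * A      ≡⟨ cong (λ h → h * x + (x - r) * A) (horner-factor v p x r) ⟩
    ((x - r) * H) * x + (x - r) * A ≡⟨ collect x r H A ⟩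
    (x - r) * (H * x + A)          ∎
    where
    P A w H : ℤ
    P = horner v (suc p) x
    A = horner v (suc p) r
    w = v (suc p)
    H = horner (λ c → horner v (suc c) r) p x
    split : ∀ P A x r w → (P * x + w) - (A * r + w) ≡ (P - A) * x + (x - r) * A
    split = solve-∀
    collect : ∀ x r H A → ((x - r) * H) * x + (x - r) * A ≡ (x - r) * (H * x + A)
    collect = solve-∀

  hornerColumns : ℤ → ℕ → Matrix → Matrix
  hornerColumns r p N i c with c ℕ.<? p
  ... | yes _ = horner (N i) (suc c) r
  ... | no _  = N i c

  hornerColumns-< : ∀ r p N i c → c < p → hornerColumns r p N i c ≡ horner (N i) (suc c) r
  hornerColumns-< r p N i c c<p with c ℕ.<? p
  ... | yes _   = refl
  ... | no c≮p = ⊥-elim (c≮p c<p)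

  hornerColumns-≥ : ∀ r p N i c → ¬ c < p → hornerColumns r p N i c ≡ N i c
  hornerColumns-≥ r p N i c c≮p with c ℕ.<? p
  ... | yes c<p = ⊥-elim (c≮p c<p)
  ... | no _    = refl

  -- Passing from t+1 to t+2 Horner columns is the column operation  col (t+1) += r · col t.
  determinant-hornerColumns : ∀ k r t N → t ≤ k → determinant k (hornerColumns r t N) ≡ determinant k N
  determinant-hornerColumns k r zero N _ = determinant-cong k (λ i c _ _ → hornerColumns-≥ r 0 N i c (λ ()))
  determinant-hornerColumns k r (suc zero) N _ = determinant-cong k (λ i c _ _ → first-column i c)
    where
    first-column : ∀ i c → hornerColumns r 1 N i c ≡ N i c
    first-column i zero    = trans (hornerColumns-< r 1 N i 0 (s≤s z≤n)) (ℤ.+-identityˡ (N i 0))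
    first-column i (suc c) = hornerColumns-≥ r 1 N i (suc c) (λ { (s≤s ()) })
  determinant-hornerColumns k r (suc (suc t)) N t<k =
    trans (determinant-add-column k t r t<k unchanged added)
          (determinant-hornerColumns k r (suc t) N (ℕ.≤-trans (ℕ.n≤1+n _) t<k))
    where
    unchanged : ∀ i x → x ≢ suc t → hornerColumns r (2 ℕ.+ t) N i x ≡ hornerColumns r (suc t) N i x
    unchanged i x x≢1+t = by-cases (x ℕ.<? suc t)
      where
      by-cases : Dec (x < suc t) → hornerColumns r (2 ℕ.+ t) N i x ≡ hornerColumns r (suc t) N i x
      by-cases (yes x<1+t) = trans (hornerColumns-< r (2 ℕ.+ t) N i x (ℕ.m≤n⇒m≤1+n x<1+t))
                                   (sym (hornerColumns-< r (suc t) N i x x<1+t))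
      by-cases (no x≮1+t)  = trans (hornerColumns-≥ r (2 ℕ.+ t) N i x
                                     (λ x<2+t → x≮1+t (ℕ.≤∧≢⇒< (ℕ.≤-pred x<2+t) x≢1+t)))
                                   (sym (hornerColumns-≥ r (suc t) N i x x≮1+t))
    added : ∀ i → hornerColumns r (2 ℕ.+ t) N i (suc t)
                  ≡ hornerColumns r (suc t) N i (suc t) + r * hornerColumns r (suc t) N i t
    added i = begin
      hornerColumns r (2 ℕ.+ t) N i (suc t)
        ≡⟨ hornerColumns-< r (2 ℕ.+ t) N i (suc t) ℕ.≤-refl ⟩
      horner (N i) (suc t) r * r + N i (suc t)
        ≡⟨ swap (horner (N i) (suc t) r) r (N i (suc t)) ⟩
      N i (suc t) + r * horner (N i) (suc t) r
        ≡⟨ cong₂ (λ a h → a + r * h) (sym (hornerColumns-≥ r (suc t) N i (suc t) (ℕ.n≮n (suc t))))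
                                   (sym (hornerColumns-< r (suc t) N i t ℕ.≤-refl)) ⟩
      hornerColumns r (suc t) N i (suc t) + r * hornerColumns r (suc t) N i t ∎
      where
      swap : ∀ h r a → h * r + a ≡ a + r * h
      swap = solve-∀

  module CommonRoots (Q : ℤ) (euclid : ∀ a b → Q ∣ a * b → ¬ Q ∣ a → Q ∣ b) where

    -- Only the first p columns are read as polynomial coefficients; the others are already divisible by Q.
    pow∣determinant-roots : ∀ rs k p N → length rs ≤ p → p ≤ k →
      (∀ i c → i < k → p ≤ c → c < k → Q ∣ N i c) →
      (∀ i → i < k → All (λ s → Q ∣ horner (N i) p s) rs) →
      AllPairs (λ r s → ¬ Q ∣ r - s) rs →
      Q ^ (length rs ℕ.+ (k ∸ p)) ∣ determinant k N
    pow∣determinant-roots [] k p N _ _ Q∣N _ _ = pow∣determinant k p Q Q∣N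
    pow∣determinant-roots (r ∷ rs) k (suc p) N (s≤s rs≤p) p<k Q∣N roots (r-apart ∷ rs-apart) =
      subst₂ (λ e D → Q ^ e ∣ D) exponent (determinant-hornerColumns k r (suc p) N p<k)
        (pow∣determinant-roots rs k p N′ rs≤p (ℕ.≤-trans (ℕ.n≤1+n p) p<k) Q∣N′ roots′ rs-apart)
      where
      N′ : Matrix
      N′ = hornerColumns r (suc p) N

      exponent : length rs ℕ.+ (k ∸ p) ≡ suc (length rs) ℕ.+ (k ∸ suc p)
      exponent = trans (cong (length rs ℕ.+_) (ℕ.+-∸-assoc 1 p<k)) (ℕ.+-suc (length rs) (k ∸ suc p))

      Q∣N′ : ∀ i c → i < k → p ≤ c → c < k → Q ∣ N′ i c
      Q∣N′ i c i<k p≤c c<k with c ℕ.<? suc p | roots i i<k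
      ... | yes c<1+p | root ∷ _ =
        subst (λ y → Q ∣ horner (N i) (suc y) r) (ℕ.≤-antisym p≤c (ℕ.≤-pred c<1+p)) root
      ... | no c≮1+p  | _ = Q∣N i c i<k (ℕ.≰⇒> (c≮1+p ∘ s≤s)) c<k

      quotient-root : ∀ i s → Q ∣ horner (N i) (suc p) r → Q ∣ horner (N i) (suc p) s → ¬ Q ∣ r - s →
                      Q ∣ horner (N′ i) p s
      quotient-root i s r-root s-root r≢s = subst (Q ∣_)
        (horner-cong p s (λ c c<p → sym (hornerColumns-< r (suc p) N i c (ℕ.m≤n⇒m≤1+n c<p))))
        (euclid (s - r) _ (subst (Q ∣_) (horner-factor (N i) p s r) (∣m∣n⇒∣m-n s-root r-root))
                          (λ Q∣s-r → r≢s (subst (Q ∣_) (negate s r) (∣m⇒∣-m Q∣s-r))))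
        where
        negate : ∀ s r → - (s - r) ≡ r - s
        negate = solve-∀

      roots′ : ∀ i → i < k → All (λ s → Q ∣ horner (N′ i) p s) rs
      roots′ i i<k = go (roots i i<k) r-apart
        where
        go : ∀ {ss} → All (λ s → Q ∣ horner (N i) (suc p) s) (r ∷ ss) → All (λ s → ¬ Q ∣ r - s) ss →
             All (λ s → Q ∣ horner (N′ i) p s) ss
        go _ [] = []
        go (r-root ∷ s-root ∷ roots) (r≢s ∷ apart) = quotient-root i _ r-root s-root r≢s ∷ go (r-root ∷ roots) apart

    pow∣determinant-common-roots : ∀ rs k N → length rs ≤ k →
      (∀ i → i < k → All (λ s → Q ∣ horner (N i) k s) rs) →
      AllPairs (λ r s → ¬ Q ∣ r - s) rs →
      Q ^ length rs ∣ determinant k N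
    pow∣determinant-common-roots rs k N rs≤k roots apart =
      subst (λ e → Q ^ e ∣ determinant k N) (trans (cong (length rs ℕ.+_) (ℕ.n∸n≡0 k)) (ℕ.+-identityʳ _))
        (pow∣determinant-roots rs k k N rs≤k ℕ.≤-refl (λ i c _ k≤c c<k → ⊥-elim (ℕ.≤⇒≯ k≤c c<k)) roots apart)

  sumℤ-scale : ∀ {k} x (f : Fin k → ℤ) → sumℤ (λ i → x * f i) ≡ x * sumℤ f
  sumℤ-scale {zero}  x f = sym (ℤ.*-zeroʳ x)
  sumℤ-scale {suc k} x f =
    trans (cong (λ s → x * f Fin.zero + s) (sumℤ-scale x (f ∘ Fin.suc))) (sym (ℤ.*-distribˡ-+ x (f Fin.zero) _))

  eval-suc : ∀ {n} (a : Fin (2 ℕ.+ n) → ℤ) x → eval a x ≡ a Fin.zero + x * eval (a ∘ Fin.suc) x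
  eval-suc a x = cong₂ _+_ (ℤ.*-identityʳ (a Fin.zero))
    (trans (sumℤ-cong (λ i → exchange (a (Fin.suc i)) x (x ^ toℕ i))) (sumℤ-scale x (λ i → a (Fin.suc i) * x ^ toℕ i)))
    where
    exchange : ∀ a x y → a * (x * y) ≡ x * (a * y)
    exchange = solve-∀

  eval-zero : ∀ {n} (a : Fin (suc n) → ℤ) → eval a (+ 0) ≡ a Fin.zero
  eval-zero a = trans (cong₂ _+_ (ℤ.*-identityʳ (a Fin.zero)) (sumℤ-zero λ i → ℤ.*-zeroʳ (a (Fin.suc i))))
                      (ℤ.+-identityʳ _)
    where
    sumℤ-zero : ∀ {k} {f : Fin k → ℤ} → (∀ i → f i ≡ + 0) → sumℤ f ≡ + 0
    sumℤ-zero {zero}  f≡0 = refl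
    sumℤ-zero {suc k} f≡0 = cong₂ _+_ (f≡0 Fin.zero) (sumℤ-zero (f≡0 ∘ Fin.suc))

  coeff-< : ∀ {n} (a : Fin (suc n) → ℤ) i (i<1+n : i < suc n) → coeff a i ≡ a (Fin.fromℕ< i<1+n)
  coeff-< {n} a i i<1+n with i ℕ.<? suc n
  ... | yes _       = refl
  ... | no i≮1+n   = ⊥-elim (i≮1+n i<1+n)

  coeff-≥ : ∀ {n} (a : Fin (suc n) → ℤ) i → ¬ i < suc n → coeff a i ≡ + 0
  coeff-≥ {n} a i i≮1+n with i ℕ.<? suc n
  ... | yes i<1+n = ⊥-elim (i≮1+n i<1+n)
  ... | no _      = refl

  coeff-suc : ∀ {n} (a : Fin (2 ℕ.+ n) → ℤ) i → coeff a (suc i) ≡ coeff (a ∘ Fin.suc) i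
  coeff-suc {n} a i = by-cases (i ℕ.<? suc n)
    where
    by-cases : Dec (i < suc n) → coeff a (suc i) ≡ coeff (a ∘ Fin.suc) i
    by-cases (yes i<1+n) = trans (coeff-< a (suc i) (s≤s i<1+n)) (sym (coeff-< (a ∘ Fin.suc) i i<1+n))
    by-cases (no i≮1+n)  = trans (coeff-≥ a (suc i) (i≮1+n ∘ ℕ.≤-pred)) (sym (coeff-≥ (a ∘ Fin.suc) i i≮1+n))

  horner-reversed : ∀ n (a : Fin (suc n) → ℤ) x → horner (λ d → coeff a (n ∸ d)) (suc n) x ≡ eval a x
  horner-reversed zero a x = trans (cong (λ c → + 0 * x + c) (coeff-< a 0 (s≤s z≤n))) (constant (a Fin.zero) x)
    where
    constant : ∀ a x → + 0 * x + a ≡ a * + 1 + + 0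
    constant = solve-∀
  horner-reversed (suc n) a x = begin
    horner (λ d → coeff a (suc n ∸ d)) (suc n) x * x + coeff a (n ∸ n)
      ≡⟨ cong₂ (λ h c → h * x + c)
           (horner-cong (suc n) x λ d d<1+n → trans (cong (coeff a) (ℕ.+-∸-assoc 1 (ℕ.≤-pred d<1+n))) (coeff-suc a (n ∸ d)))
           (trans (cong (coeff a) (ℕ.n∸n≡0 n)) (coeff-< a 0 (s≤s z≤n))) ⟩
    horner (λ d → coeff (a ∘ Fin.suc) (n ∸ d)) (suc n) x * x + a Fin.zero
      ≡⟨ cong (λ e → e * x + a Fin.zero) (horner-reversed n (a ∘ Fin.suc) x) ⟩
    eval (a ∘ Fin.suc) x * x + a Fin.zero
      ≡⟨ swap (eval (a ∘ Fin.suc) x) x (a Fin.zero) ⟩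
    a Fin.zero + x * eval (a ∘ Fin.suc) x
      ≡⟨ eval-suc a x ⟨
    eval a x ∎
    where
    swap : ∀ e x a → e * x + a ≡ a + x * e
    swap = solve-∀

  shifted-inside : ∀ {n} (a : Fin (suc n) → ℤ) {s j} → s ≤ j → j ≤ n ℕ.+ s → shifted a s j ≡ coeff a (n ℕ.+ s ∸ j)
  shifted-inside {n} a {s} {j} s≤j j≤n+s with s ℕ.≤? j | j ℕ.≤? n ℕ.+ s
  ... | yes _   | yes _   = refl
  ... | no s≰j  | _       = ⊥-elim (s≰j s≤j)
  ... | yes _   | no j≰n+s = ⊥-elim (j≰n+s j≤n+s)

  shifted-outside : ∀ {n} (a : Fin (suc n) → ℤ) {s j} → ¬ s ≤ j ⊎ ¬ j ≤ n ℕ.+ s → shifted a s j ≡ + 0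
  shifted-outside {n} a {s} {j} outside with s ℕ.≤? j | j ℕ.≤? n ℕ.+ s | outside
  ... | yes s≤j | yes _     | inj₁ s≰j   = ⊥-elim (s≰j s≤j)
  ... | yes _   | yes j≤n+s | inj₂ j≰n+s = ⊥-elim (j≰n+s j≤n+s)
  ... | no _    | _         | _          = refl
  ... | yes _   | no _      | _          = refl

  horner-≡0 : ∀ p {v} x → (∀ c → c < p → v c ≡ + 0) → horner v p x ≡ + 0
  horner-≡0 zero    x v≡0 = refl
  horner-≡0 (suc p) x v≡0 =
    trans (cong₂ (λ h c → h * x + c) (horner-≡0 p x (λ c c<p → v≡0 c (ℕ.m≤n⇒m≤1+n c<p))) (v≡0 p ℕ.≤-refl))
          (ℤ.*-zeroˡ x)

  horner-leading-zeros : ∀ s e {v} x → (∀ c → c < s → v c ≡ + 0) →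
    horner v (s ℕ.+ e) x ≡ horner (λ d → v (s ℕ.+ d)) e x
  horner-leading-zeros s zero    x v≡0 = trans (cong (λ p → horner _ p x) (ℕ.+-identityʳ s)) (horner-≡0 s x v≡0)
  horner-leading-zeros s (suc e) {v} x v≡0 = trans (cong (λ p → horner v p x) (ℕ.+-suc s e))
    (cong (λ h → h * x + v (s ℕ.+ e)) (horner-leading-zeros s e x v≡0))

  horner-trailing-zeros : ∀ p z {w} x → (∀ d → p ≤ d → w d ≡ + 0) → horner w (p ℕ.+ z) x ≡ horner w p x * x ^ z
  horner-trailing-zeros p zero    x w≡0 = trans (cong (λ e → horner _ e x) (ℕ.+-identityʳ p)) (sym (ℤ.*-identityʳ _))
  horner-trailing-zeros p (suc z) {w} x w≡0 = begin
    horner w (p ℕ.+ suc z) x                     ≡⟨ cong (λ e → horner w e x) (ℕ.+-suc p z) ⟩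
    horner w (p ℕ.+ z) x * x + w (p ℕ.+ z)       ≡⟨ cong₂ (λ h c → h * x + c) (horner-trailing-zeros p z x w≡0)
                                                                                (w≡0 _ (ℕ.m≤m+n p z)) ⟩
    horner w p x * x ^ z * x + + 0              ≡⟨ regroup (horner w p x) x (x ^ z) ⟩
    horner w p x * x ^ suc z                     ∎
    where
    regroup : ∀ h x y → h * y * x + + 0 ≡ h * (x * y)
    regroup = solve-∀

  horner-shifted : ∀ {n} (a : Fin (suc n) → ℤ) s z x → horner (shifted a s) (s ℕ.+ (suc n ℕ.+ z)) x ≡ eval a x * x ^ z
  horner-shifted {n} a s z x = begin
    horner (shifted a s) (s ℕ.+ (suc n ℕ.+ z)) x
      ≡⟨ horner-leading-zeros s (suc n ℕ.+ z) x (λ c c<s → shifted-outside a (inj₁ (ℕ.<⇒≱ c<s))) ⟩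
    horner (λ d → shifted a s (s ℕ.+ d)) (suc n ℕ.+ z) x
      ≡⟨ horner-trailing-zeros (suc n) z x (λ d n<d → shifted-outside a (inj₂ (beyond n<d))) ⟩
    horner (λ d → shifted a s (s ℕ.+ d)) (suc n) x * x ^ z
      ≡⟨ cong (_* x ^ z) (horner-cong (suc n) x λ d d<1+n →
           trans (shifted-inside a (ℕ.m≤m+n s d) (within d<1+n)) (cong (coeff a) (index d))) ⟩
    horner (λ d → coeff a (n ∸ d)) (suc n) x * x ^ z
      ≡⟨ cong (_* x ^ z) (horner-reversed n a x) ⟩
    eval a x * x ^ z ∎
    where
    beyond : ∀ {d} → suc n ≤ d → ¬ s ℕ.+ d ≤ n ℕ.+ s
    beyond {d} n<d = ℕ.<⇒≱ (subst (n ℕ.+ s <_) (ℕ.+-comm d s) (ℕ.+-monoˡ-< s n<d))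
    within : ∀ {d} → d < suc n → s ℕ.+ d ≤ n ℕ.+ s
    within {d} d<1+n = subst (s ℕ.+ d ≤_) (ℕ.+-comm s n) (ℕ.+-monoʳ-≤ s (ℕ.≤-pred d<1+n))
    index : ∀ d → n ℕ.+ s ∸ (s ℕ.+ d) ≡ n ∸ d
    index d = trans (cong (_∸ (s ℕ.+ d)) (ℕ.+-comm n s)) (ℕ.[m+n]∸[m+o]≡n∸o s n d)

  sylvesterMatrix : ∀ {n m} → (Fin (suc n) → ℤ) → (Fin (suc m) → ℤ) → Matrix
  sylvesterMatrix {m = m} a b r c with r ℕ.<? m
  ... | yes _ = shifted a r c
  ... | no _  = shifted b (r ∸ m) c

  resultant≡determinant : ∀ {n m} (a : Fin (suc n) → ℤ) (b : Fin (suc m) → ℤ) →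
    resultant a b ≡ determinant (m ℕ.+ n) (sylvesterMatrix a b)
  resultant≡determinant {n} {m} a b = trans (det-cong same-entries) (det≡determinant (m ℕ.+ n) (sylvesterMatrix a b))
    where
    same-entries : ∀ r c → sylvester a b r c ≡ sylvesterMatrix a b (toℕ r) (toℕ c)
    same-entries r c with toℕ r ℕ.<? m
    ... | yes _ = refl
    ... | no _  = refl

  sylvesterMatrix-top : ∀ {n m} (a : Fin (suc n) → ℤ) (b : Fin (suc m) → ℤ) {i} → i < m →
    ∀ c → sylvesterMatrix a b i c ≡ shifted a i c
  sylvesterMatrix-top {m = m} a b {i} i<m c with i ℕ.<? m
  ... | yes _  = refl
  ... | no i≮m = ⊥-elim (i≮m i<m)

  sylvesterMatrix-bottom : ∀ {n m} (a : Fin (suc n) → ℤ) (b : Fin (suc m) → ℤ) {i} → ¬ i < m →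
    ∀ c → sylvesterMatrix a b i c ≡ shifted b (i ∸ m) c
  sylvesterMatrix-bottom {m = m} a b {i} i≮m c with i ℕ.<? m
  ... | yes i<m = ⊥-elim (i≮m i<m)
  ... | no _    = refl

  horner-sylvester-top : ∀ {n m} (a : Fin (suc n) → ℤ) (b : Fin (suc m) → ℤ) x {i} → i < m →
    horner (sylvesterMatrix a b i) (m ℕ.+ n) x ≡ eval a x * x ^ (m ∸ suc i)
  horner-sylvester-top {n} {m} a b x {i} i<m = begin
    horner (sylvesterMatrix a b i) (m ℕ.+ n) x
      ≡⟨ horner-cong (m ℕ.+ n) x (λ c _ → sylvesterMatrix-top a b i<m c) ⟩
    horner (shifted a i) (m ℕ.+ n) x
      ≡⟨ cong (λ p → horner (shifted a i) p x) width ⟩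
    horner (shifted a i) (i ℕ.+ (suc n ℕ.+ (m ∸ suc i))) x
      ≡⟨ horner-shifted a i (m ∸ suc i) x ⟩
    eval a x * x ^ (m ∸ suc i) ∎
    where
    rearrange : ∀ i n t → suc i ℕ.+ t ℕ.+ n ≡ i ℕ.+ (suc n ℕ.+ t)
    rearrange = NS.solve-∀
    width : m ℕ.+ n ≡ i ℕ.+ (suc n ℕ.+ (m ∸ suc i))
    width = trans (cong (ℕ._+ n) (sym (ℕ.m+[n∸m]≡n i<m))) (rearrange i n (m ∸ suc i))

  horner-sylvester-bottom : ∀ {n m} (a : Fin (suc n) → ℤ) (b : Fin (suc m) → ℤ) x {i} → ¬ i < m → i < m ℕ.+ n →
    horner (sylvesterMatrix a b i) (m ℕ.+ n) x ≡ eval b x * x ^ (n ∸ suc (i ∸ m))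
  horner-sylvester-bottom {n} {m} a b x {i} i≮m i<m+n = begin
    horner (sylvesterMatrix a b i) (m ℕ.+ n) x
      ≡⟨ horner-cong (m ℕ.+ n) x (λ c _ → sylvesterMatrix-bottom a b i≮m c) ⟩
    horner (shifted b j) (m ℕ.+ n) x
      ≡⟨ cong (λ p → horner (shifted b j) p x) width ⟩
    horner (shifted b j) (j ℕ.+ (suc m ℕ.+ (n ∸ suc j))) x
      ≡⟨ horner-shifted b j (n ∸ suc j) x ⟩
    eval b x * x ^ (n ∸ suc j) ∎
    where
    j : ℕ
    j = i ∸ m
    m+j≡i : m ℕ.+ j ≡ i
    m+j≡i = ℕ.m+[n∸m]≡n (ℕ.≮⇒≥ i≮m)
    j<n : j < n
    j<n = ℕ.+-cancelˡ-< m j n (subst (_< m ℕ.+ n) (sym m+j≡i) i<m+n)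
    rearrange : ∀ m j t → m ℕ.+ (suc j ℕ.+ t) ≡ j ℕ.+ (suc m ℕ.+ t)
    rearrange = NS.solve-∀
    width : m ℕ.+ n ≡ j ℕ.+ (suc m ℕ.+ (n ∸ suc j))
    width = trans (cong (m ℕ.+_) (sym (ℕ.m+[n∸m]≡n j<n))) (rearrange m j (n ∸ suc j))

  sylvester-row-root : ∀ {n m} (a : Fin (suc n) → ℤ) (b : Fin (suc m) → ℤ) {d} x i → i < m ℕ.+ n →
    d ∣ eval a x → d ∣ eval b x → d ∣ horner (sylvesterMatrix a b i) (m ℕ.+ n) x
  sylvester-row-root {n} {m} a b {d} x i i<m+n d∣fx d∣gx = by-cases (i ℕ.<? m)
    where
    by-cases : Dec (i < m) → d ∣ horner (sylvesterMatrix a b i) (m ℕ.+ n) x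
    by-cases (yes i<m) = subst (d ∣_) (sym (horner-sylvester-top a b x i<m)) (∣m⇒∣m*n _ d∣fx)
    by-cases (no i≮m)  = subst (d ∣_) (sym (horner-sylvester-bottom a b x i≮m i<m+n)) (∣m⇒∣m*n _ d∣gx)

  eval-monomial : ∀ k (u : Fin (suc k) → ℤ) x → (∀ i → toℕ i ≢ k → u i ≡ + 0) → u (fromℕ k) ≡ + 1 →
    eval u x ≡ x ^ k
  eval-monomial zero    u x _ u-top≡1 = trans (cong (λ c → c * + 1 + + 0) u-top≡1) refl
  eval-monomial (suc k) u x u≡0 u-top≡1 = begin
    eval u x                                ≡⟨ eval-suc u x ⟩
    u Fin.zero + x * eval (u ∘ Fin.suc) x   ≡⟨ cong₂ (λ c e → c + x * e) (u≡0 Fin.zero (λ ())) tail≡ ⟩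
    + 0 + x * x ^ k                         ≡⟨ ℤ.+-identityˡ _ ⟩
    x ^ suc k                               ∎
    where
    tail≡ : eval (u ∘ Fin.suc) x ≡ x ^ k
    tail≡ = eval-monomial k (u ∘ Fin.suc) x (λ i i≢k → u≡0 (Fin.suc i) (i≢k ∘ ℕ.suc-injective)) u-top≡1

  eval-xPowMinusOne : ∀ m x → eval (xPowMinusOne (suc m)) x ≡ x ^ suc m - + 1
  eval-xPowMinusOne m x = begin
    eval (xPowMinusOne (suc m)) x
      ≡⟨ eval-suc (xPowMinusOne (suc m)) x ⟩
    - + 1 + x * eval (xPowMinusOne (suc m) ∘ Fin.suc) x
      ≡⟨ cong (λ e → - + 1 + x * e) (eval-monomial m _ x middle≡0 top≡1) ⟩
    - + 1 + x * x ^ m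
      ≡⟨ ℤ.+-comm (- + 1) (x ^ suc m) ⟩
    x ^ suc m - + 1 ∎
    where
    middle≡0 : ∀ i → toℕ i ≢ m → xPowMinusOne (suc m) (Fin.suc i) ≡ + 0
    middle≡0 i i≢m with suc (toℕ i) ℕ.≟ suc m
    ... | yes 1+i≡1+m = ⊥-elim (i≢m (ℕ.suc-injective 1+i≡1+m))
    ... | no _        = refl
    top≡1 : xPowMinusOne (suc m) (Fin.suc (fromℕ m)) ≡ + 1
    top≡1 with suc (toℕ (fromℕ m)) ℕ.≟ suc m
    ... | yes _       = refl
    ... | no top≢1+m  = ⊥-elim (top≢1+m (cong suc (Fin.toℕ-fromℕ m)))

  ∣-sum : ∀ {k d} {f : Vector ℤ k} → (∀ i → d ∣ f i) → d ∣ sum f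
  ∣-sum {zero}  d∣f = divides (+ 0) refl
  ∣-sum {suc k} d∣f = ∣m∣n⇒∣m+n (d∣f Fin.zero) (∣-sum (d∣f ∘ Fin.suc))

  ×≡* : ∀ n z → n Raw.× z ≡ + n * z
  ×≡* zero    z = sym (ℤ.*-zeroˡ z)
  ×≡* (suc n) z = trans (cong (λ w → z + w) (×≡* n z)) (sym (ℤ.suc-* (+ n) z))

  ^≡^ : ∀ x n → x Raw.^ n ≡ x ^ n
  ^≡^ x zero    = refl
  ^≡^ x (suc n) = cong (x *_) (^≡^ x n)

  binomial-absorption : ∀ n k → suc k ℕ.* (suc n C suc k) ≡ suc n ℕ.* (n C k)
  binomial-absorption n zero = trans (ℕ.+-identityʳ _) (trans (nC1≡n (suc n)) (sym (ℕ.*-identityʳ (suc n))))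
  binomial-absorption zero (suc k) = ℕ.*-zeroʳ (suc (suc k))
  binomial-absorption (suc n) (suc k) = begin
    suc (suc k) ℕ.* (suc (suc n) C suc (suc k))
      ≡⟨ cong (suc (suc k) ℕ.*_) (sym (nCk+nC[k+1]≡[n+1]C[k+1] (suc n) (suc k))) ⟩
    suc (suc k) ℕ.* (A ℕ.+ B)
      ≡⟨ expand k A B ⟩
    A ℕ.+ suc k ℕ.* A ℕ.+ suc (suc k) ℕ.* B
      ≡⟨ cong₂ (λ u v → A ℕ.+ u ℕ.+ v) (binomial-absorption n k) (binomial-absorption n (suc k)) ⟩
    A ℕ.+ suc n ℕ.* (n C k) ℕ.+ suc n ℕ.* (n C suc k)
      ≡⟨ collect n A (n C k) (n C suc k) ⟩
    A ℕ.+ suc n ℕ.* (n C k ℕ.+ n C suc k)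
      ≡⟨ cong (λ u → A ℕ.+ suc n ℕ.* u) (nCk+nC[k+1]≡[n+1]C[k+1] n k) ⟩
    suc (suc n) ℕ.* A ∎
    where
    A B : ℕ
    A = suc n C suc k
    B = suc n C suc (suc k)
    expand : ∀ k A B → suc (suc k) ℕ.* (A ℕ.+ B) ≡ A ℕ.+ suc k ℕ.* A ℕ.+ suc (suc k) ℕ.* B
    expand = NS.solve-∀
    collect : ∀ n A c₁ c₂ → A ℕ.+ suc n ℕ.* c₁ ℕ.+ suc n ℕ.* c₂ ≡ A ℕ.+ suc n ℕ.* (c₁ ℕ.+ c₂)
    collect = NS.solve-∀

  prime∣binomial : ∀ {p} → Prime p → ∀ {k} → 0 < k → k < p → p ℕ.∣ p C k
  prime∣binomial {suc n} p-prime {suc k} _ k<p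
    with euclidsLemma (suc k) (suc n C suc k) p-prime
           (subst (suc n ℕ.∣_) (sym (binomial-absorption n k)) (ℕ.m∣m*n (n C k)))
  ... | inj₁ p∣k = ⊥-elim (ℕ.<⇒≱ k<p (ℕ.∣⇒≤ p∣k))
  ... | inj₂ p∣C = p∣C

  freshman's-dream : ∀ {p} → Prime p → ∀ x → + p ∣ (x + + 1) ^ p - x ^ p - + 1
  freshman's-dream {suc p} p-prime x = subst (+ suc p ∣_) (sym cancel-ends) (∣-sum middle-divisible)
    where
    term : ℕ → ℤ
    term k = + (suc p C k) * (x ^ k * (+ 1) ^ (suc p ∸ k))

    t : Vector ℤ (2 ℕ.+ p)
    t = binomialTerm x (+ 1) (suc p)

    t≡term : ∀ k → t k ≡ term (toℕ k)
    t≡term k = trans (×≡* (suc p C toℕ k) _)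
      (cong (+ (suc p C toℕ k) *_) (cong₂ _*_ (^≡^ x (toℕ k)) (^≡^ (+ 1) (suc p ∸ toℕ k))))

    first : term 0 ≡ + 1
    first = trans (ℤ.*-identityˡ _) (trans (ℤ.*-identityˡ _) (ℤ.^-zeroˡ (suc p)))

    last : t (Fin.suc (fromℕ p)) ≡ x ^ suc p
    last rewrite t≡term (Fin.suc (fromℕ p)) | Fin.toℕ-fromℕ p | nCn≡1 (suc p) | ℕ.n∸n≡0 p =
      trans (ℤ.*-identityˡ _) (ℤ.*-identityʳ _)

    middle-divisible : ∀ j → + suc p ∣ init (tail t) j
    middle-divisible j = subst (+ suc p ∣_) (sym (t≡term (Fin.suc (inject₁ j))))
      (∣m⇒∣m*n _ (∣ᵤ⇒∣ {i = + (suc p C k)} (prime∣binomial p-prime (s≤s z≤n) k<p)))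
      where
      k : ℕ
      k = suc (toℕ (inject₁ j))
      k<p : k < suc p
      k<p = s≤s (subst (_< p) (sym (Fin.toℕ-inject₁ j)) (Fin.toℕ<n j))

    cancel-ends : (x + + 1) ^ suc p - x ^ suc p - + 1 ≡ sum (init (tail t))
    cancel-ends = begin
      (x + + 1) ^ suc p - x ^ suc p - + 1
        ≡⟨ cong (λ e → e - x ^ suc p - + 1) (^≡^ (x + + 1) (suc p)) ⟨
      (x + + 1) Raw.^ suc p - x ^ suc p - + 1
        ≡⟨ cong (λ e → e - x ^ suc p - + 1) (binomial-theorem (suc p) x (+ 1)) ⟩
      t Fin.zero + sum (tail t) - x ^ suc p - + 1
        ≡⟨ cong (λ e → t Fin.zero + e - x ^ suc p - + 1) (sum-init-last (tail t)) ⟩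
      t Fin.zero + (sum (init (tail t)) + t (Fin.suc (fromℕ p))) - x ^ suc p - + 1
        ≡⟨ cong₂ (λ u v → u + (sum (init (tail t)) + v) - x ^ suc p - + 1) (trans (t≡term Fin.zero) first) last ⟩
      + 1 + (sum (init (tail t)) + x ^ suc p) - x ^ suc p - + 1
        ≡⟨ cancel (sum (init (tail t))) (x ^ suc p) ⟩
      sum (init (tail t)) ∎
      where
      cancel : ∀ s y → + 1 + (s + y) - y - + 1 ≡ s
      cancel = solve-∀

  ℤ-euclidsLemma : ∀ {p} → Prime p → ∀ a b → + p ∣ a * b → ¬ + p ∣ a → + p ∣ b
  ℤ-euclidsLemma {p} p-prime a b p∣ab p∤a
    with euclidsLemma ℤ.∣ a ∣ ℤ.∣ b ∣ p-prime (subst (p ℕ.∣_) (ℤ.abs-* a b) (∣⇒∣ᵤ p∣ab))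
  ... | inj₁ p∣a = ⊥-elim (p∤a (∣ᵤ⇒∣ p∣a))
  ... | inj₂ p∣b = ∣ᵤ⇒∣ p∣b

  ∤-below : ∀ {p d} → 0 < d → d < p → ¬ + p ∣ + d
  ∤-below {d = suc d} _ d<p p∣d = ℕ.<⇒≱ d<p (ℕ.∣⇒≤ (∣⇒∣ᵤ p∣d))

  fermat-little : ∀ {p} → Prime p → ∀ x → + p ∣ (+ x) ^ p - + x
  fermat-little {suc p} _ zero = divides (+ 0) (ℤ.*-zeroˡ ((+ 0) ^ p))
  fermat-little {p} p-prime (suc x) =
    subst (+ p ∣_) (sym split) (∣m∣n⇒∣m+n (freshman's-dream p-prime (+ x)) (fermat-little p-prime x))
    where
    split : (+ suc x) ^ p - + suc x ≡ ((+ x + + 1) ^ p - (+ x) ^ p - + 1) + ((+ x) ^ p - + x)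
    split = trans (cong (λ y → y ^ p - y) (cong +_ (ℕ.+-comm 1 x))) (telescope ((+ x + + 1) ^ p) ((+ x) ^ p) (+ x))
      where
      telescope : ∀ P X y → P - (y + + 1) ≡ (P - X - + 1) + (X - y)
      telescope = solve-∀

  fermat : ∀ {p} → Prime p → ∀ {x} → 0 < x → x < p → + p ∣ (+ x) ^ (p ∸ 1) - + 1
  fermat {suc p} p-prime {x} 0<x x<p =
    ℤ-euclidsLemma p-prime (+ x) _ (subst (+ suc p ∣_) (factor (+ x) ((+ x) ^ p)) (fermat-little p-prime x))
                                   (∤-below 0<x x<p)
    where
    factor : ∀ y Y → y * Y - y ≡ y * (Y - + 1)
    factor = solve-∀

  pos-^ : ∀ q ℓ → (+ q) ^ ℓ ≡ + (q ℕ.^ ℓ)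
  pos-^ q zero    = refl
  pos-^ q (suc ℓ) = trans (cong (+ q *_) (pos-^ q ℓ)) (sym (ℤ.pos-* q (q ℕ.^ ℓ)))

  ∤-difference : ∀ {q x y} → x < y → y < q → ¬ + q ∣ + x - + y
  ∤-difference {q} {x} {y} x<y y<q q∣x-y =
    ∤-below (ℕ.m<n⇒0<n∸m x<y) (ℕ.≤-<-trans (ℕ.m∸n≤m y x) y<q) (subst (+ q ∣_) y-x (∣m⇒∣-m q∣x-y))
    where
    negate : ∀ u v → - (u - v) ≡ v - u
    negate = solve-∀
    y-x : - (+ x - + y) ≡ + (y ∸ x)
    y-x = trans (negate (+ x) (+ y)) (trans (ℤ.m-n≡m⊖n y x) (ℤ.⊖-≥ (ℕ.<⇒≤ x<y)))

  module NonzeroRoots {n} (a : Fin (suc n) → ℤ) (k : ℕ) where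

    q : ℕ
    q = 2 ℕ.+ k

    isRoot? : ∀ x → Dec (q ℕ.∣ ℤ.∣ eval a (+ x) ∣)
    isRoot? x = q ℕ.∣? ℤ.∣ eval a (+ x) ∣

    roots : List ℕ
    roots = filter isRoot? (applyUpTo suc (suc k))

    numRootsMod≡length-roots : ¬ q ℕ.∣ ℤ.∣ a Fin.zero ∣ → numRootsMod a q ≡ length roots
    numRootsMod≡length-roots q∤a₀ =
      cong length (List.filter-reject isRoot? (q∤a₀ ∘ subst (λ z → q ℕ.∣ ℤ.∣ z ∣) (eval-zero a)))

    length-roots≤ : length roots ≤ suc k
    length-roots≤ = subst (length roots ≤_) (List.length-applyUpTo suc (suc k)) (List.length-filter isRoot? _)

    roots-apart : AllPairs (λ r s → ¬ + q ∣ r - s) (List.map +_ roots)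
    roots-apart = AllPairsP.map⁺ (AllPairsP.filter⁺ isRoot?
      (AllPairsP.applyUpTo⁺₁ suc (suc k) (λ i<j j<1+k → ∤-difference (s≤s i<j) (s≤s j<1+k))))

    roots-common : Prime q → All (λ s → + q ∣ eval a s × + q ∣ eval (xPowMinusOne (suc k)) s) (List.map +_ roots)
    roots-common q-prime = AllP.map⁺ (All.zipWith common (bounds , AllP.all-filter isRoot? _))
      where
      bounds : All (λ x → 0 < x × x < q) roots
      bounds = AllP.filter⁺ isRoot? (AllP.applyUpTo⁺₁ suc (suc k) (λ i<1+k → s≤s z≤n , s≤s i<1+k))
      common : ∀ {x} → (0 < x × x < q) × q ℕ.∣ ℤ.∣ eval a (+ x) ∣ →
               + q ∣ eval a (+ x) × + q ∣ eval (xPowMinusOne (suc k)) (+ x)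
      common {x} ((0<x , x<q) , q∣fx) =
        ∣ᵤ⇒∣ q∣fx , subst (+ q ∣_) (sym (eval-xPowMinusOne k (+ x))) (fermat q-prime 0<x x<q)

  resultant-divisible : ∀ {n} (a : Fin (suc n) → ℤ) k → Prime (2 ℕ.+ k) → ¬ (2 ℕ.+ k) ℕ.∣ ℤ.∣ a Fin.zero ∣ →
    + ((2 ℕ.+ k) ℕ.^ numRootsMod a (2 ℕ.+ k)) Unsigned.∣ resultant a (xPowMinusOne (suc k))
  resultant-divisible {n} a k q-prime q∤a₀ = ∣⇒∣ᵤ (subst₂ _∣_ power (sym (resultant≡determinant a b))
    (pow∣determinant-common-roots (List.map +_ roots) (suc k ℕ.+ n) (sylvesterMatrix a b) roots≤ rows roots-apart))
    where
    open NonzeroRoots a k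
    open CommonRoots (+ q) (ℤ-euclidsLemma q-prime)

    b : Fin (2 ℕ.+ k) → ℤ
    b = xPowMinusOne (suc k)

    roots≤ : length (List.map +_ roots) ≤ suc k ℕ.+ n
    roots≤ = subst (_≤ suc k ℕ.+ n) (sym (List.length-map +_ roots)) (ℕ.≤-trans length-roots≤ (ℕ.m≤m+n (suc k) n))

    rows : ∀ i → i < suc k ℕ.+ n →
           All (λ s → + q ∣ horner (sylvesterMatrix a b i) (suc k ℕ.+ n) s) (List.map +_ roots)
    rows i i<K = All.map (λ (fs , gs) → sylvester-row-root a b _ i i<K fs gs) (roots-common q-prime)

    power : (+ q) ^ length (List.map +_ roots) ≡ + (q ℕ.^ numRootsMod a q)
    power = trans (cong ((+ q) ^_) (trans (List.length-map +_ roots) (sym (numRootsMod≡length-roots q∤a₀))))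
                  (pos-^ q (numRootsMod a q))

open import Defs
open import Data.Nat using (ℕ; suc; _∸_; _^_)
open import Data.Nat.Primality using (Prime)
open import Data.Integer using (ℤ; +_; ∣_∣)
open import Data.Integer.Divisibility using (_∣_)
open import Data.Fin using (Fin; fromℕ; zero)
open import Relation.Binary.PropositionalEquality using (_≡_; _≢_; refl)
open import Relation.Nullary using (¬_)
import Data.Nat.Divisibility as ℕD
open Lemmas using (resultant-divisible)

theorem2 : (n : ℕ) (a : Fin (suc n) → ℤ) → a (fromℕ n) ≢ + 0 →
    (q : ℕ) → Prime q → q ≢ 2 → ¬ (q ℕD.∣ ∣ a zero ∣) →
    (ℓ : ℕ) → numRootsMod a q ≡ ℓ →
    + (q ^ ℓ) ∣ resultant a (xPowMinusOne (q ∸ 1))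
theorem2 n a _ (suc (suc k)) q-prime _ q∤a₀ ℓ refl = resultant-divisible a k q-prime q∤a₀
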